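{- Let $\mathcal{M}$ be a deterministic labelled transition system with state space $S$ and transition function $T$, and let $\simeq$ be a label-preserving partition on $\mathcal{M}$. Suppose that for every region $R\in S/_{\simeq}$ there exists a function $h_R\colon S\to\mathbb{N}$ such that for every $Q\in T/_{\simeq}(R)$ with $Q\neq R$, $$\forall s\in R:\; T(s)\in Q\ \lor\ \big[T(s)\in R\ \wedge\ h_R(s)>h_R(T(s))\big].$$ Then $\simeq$ is a stutter-insensitive bisimulation on $\mathcal{M}$.
   Context: A transition system $\mathcal{M}$ consists of a state space $S$, an initial region $I \subseteq S$, and a transition function $T\colon S \to 2^S\setminus\{\emptyset\}$. It is deterministic if $|T(s)|=1$ for all $s\in S$; then $T(s)$ denotes the unique successor of $s$. It is labelled if it additionally has a set of atomic propositions $AP$ and a labelling function $\langle\!\langle\cdot\rangle\!\rangle\colon S\to 2^{AP}$. A trajectory is a sequence $s_0,s_1,\dots$ with $s_{i+1}\in T(s_i)$. A partition is an equivalence relation $\simeq$ on $S$ with quotient space $S/_{\simeq}$ (the set of equivalence classes, called regions); it is label-preserving if $s\simeq t$ implies $\langle\!\langle s\rangle\!\rangle=\langle\!\langle t\rangle\!\rangle$. A state $s$ is $\simeq$-divergent if there is an infinite trajectory $s_0,s_1,\dots$ with $s_0=s$ and $s_i\simeq s$ for all $i>0$. The quotient transition function $T/_{\simeq}$ on $S/_{\simeq}$ is defined by: for $R\neq Q$, $Q\in T/_{\simeq}(R)$ iff some $s\in R$ has a successor in $Q$; $R\in T/_{\simeq}(R)$ iff some $s\in R$ is $\simeq$-divergent.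 A label-preserving partition $\simeq$ is a stutter-insensitive bisimulation if for all $s,s',t\in S$ with $s\simeq t$ and $s\not\simeq s'\in T(s)$ there is a finite trajectory $t_0,\dots,t_k$ with $t_0=t$, $t_i\simeq s$ for $i=1,\dots,k-1$, and $t_k\simeq s'$. -}

module Defs where

open import Level using (Level; _⊔_)
open import Data.Nat using (ℕ; zero; suc; _<_; _≤_)
open import Data.Bool using (Bool)
open import Data.Product using (Σ; ∃; _×_; _,_)
open import Data.Sum using (_⊎_)
open import Relation.Nullary using (¬_)
open import Relation.Binary.PropositionalEquality using (_≡_)
open import Relation.Binary.Structures using (IsEquivalence)

-- A deterministic labelled transition system: state space S, initial
-- region I ⊆ S, transition function T (|T(s)| = 1, so T(s) is given as a
-- single successor), atomic propositions AP and labelling S → 2^AP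
-- (a subset of AP is represented by its characteristic function AP → Bool).
record DLTS (a b : Level) : Set (Level.suc (a ⊔ b)) where
  field
    S     : Set a
    I     : S → Set a
    T     : S → S
    AP    : Set b
    label : S → AP → Bool

module _ {a b ℓ : Level} (M : DLTS a b) where
  open DLTS M

  record Partition : Set (a ⊔ Level.suc ℓ) where
    field
      _≃_   : S → S → Set ℓ
      isEquivalence : IsEquivalence _≃_

  module _ (P : Partition) where
    open Partition P

    LabelPreserving : Set (a ⊔ b ⊔ ℓ)
    LabelPreserving = ∀ s t → s ≃ t → ∀ (p : AP) → label s p ≡ label t p

    Divergent : S → Set (a ⊔ ℓ)
    Divergent s = Σ (ℕ → S) λ f →
      (f 0 ≡ s) × (∀ i → f (suc i) ≡ T (f i)) × (∀ i → f (suc i) ≃ s)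

    -- regions are represented by representatives: [q] ∈ T/≃([r])
    QuotStep : S → S → Set (a ⊔ ℓ)
    QuotStep r q =
        ((¬ (q ≃ r)) × (Σ S λ s → (s ≃ r) × (T s ≃ q)))
      ⊎ ((q ≃ r) × (Σ S λ s → (s ≃ r) × Divergent s))

    StutterInsensitiveBisimulation : Set (a ⊔ b ⊔ ℓ)
    StutterInsensitiveBisimulation =
      LabelPreserving ×
      (∀ s s' t → s ≃ t → ¬ (s ≃ s') → s' ≡ T s →
        Σ ℕ λ k → Σ (ℕ → S) λ f →
            (f 0 ≡ t)
          × (∀ i → i < k → f (suc i) ≡ T (f i))
          × (∀ i → 0 < i → i < k → f i ≃ s)
          × (f k ≃ s'))

{-# OPTIONS --safe #-}
module Submission where

-- Leaving the region of s along the edge s → T s is an edge of the quotient,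
-- so the hypothesis for that edge makes h_[s] a ranking function: from any
-- t ≃ s, each step either enters [T s] or stays in [s] while strictly
-- decreasing h_[s]. Well-founded induction on h_[s] therefore yields a finite
-- trajectory from t that stutters in [s] and then reaches [T s].

open import Defs
open import Level using (Level; _⊔_)
open import Data.Nat using (ℕ; zero; suc; _<_; s≤s; z≤n)
open import Data.Nat.Induction using (<-wellFounded)
open import Data.Product using (Σ; _×_; _,_; proj₁; proj₂)
open import Data.Sum using (_⊎_; inj₁; inj₂)
open import Function using (_∘_; const)
open import Induction.WellFounded using (Acc; acc)
open import Relation.Nullary using (¬_)
open import Relation.Binary.PropositionalEquality using (_≡_; refl; sym; subst)
open import Relation.Binary.Structures using (IsEquivalence)

_◂_ : ∀ {a} {S : Set a} → S → (ℕ → S) → ℕ → S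
(u ◂ g) zero    = u
(u ◂ g) (suc i) = g i

module _ {a ℓ : Level} {S : Set a} (T : S → S) (R Q : S → Set ℓ) where

  StutterRun : S → Set (a ⊔ ℓ)
  StutterRun u = Σ ℕ λ k → Σ (ℕ → S) λ f →
      (f 0 ≡ u)
    × (∀ i → i < k → f (suc i) ≡ T (f i))
    × (∀ i → 0 < i → i < k → R (f i))
    × Q (f k)

  stutterRun-exit : ∀ {u} → Q (T u) → StutterRun u
  stutterRun-exit {u} QTu = 1 , u ◂ const (T u) , refl , steps , (λ { (suc _) _ (s≤s ()) }) , QTu
    where
    steps : ∀ i → i < 1 → (u ◂ const (T u)) (suc i) ≡ T ((u ◂ const (T u)) i)
    steps zero    _         = refl
    steps (suc _) (s≤s ())

  stutterRun-stutter : ∀ {u} → R (T u) → StutterRun (T u) → StutterRun u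
  stutterRun-stutter {u} RTu (k , g , g0 , gsteps , ginside , gQ) =
    suc k , u ◂ g , refl , steps , inside , gQ
    where
    steps : ∀ i → i < suc k → (u ◂ g) (suc i) ≡ T ((u ◂ g) i)
    steps zero    _         = g0
    steps (suc i) (s≤s i<k) = gsteps i i<k

    inside : ∀ i → 0 < i → i < suc k → R ((u ◂ g) i)
    inside 1             _ _         = subst R (sym g0) RTu
    inside (suc (suc i)) _ (s≤s i<k) = ginside (suc i) (s≤s z≤n) i<k

  ranking⇒stutterRun : (h : S → ℕ) →
    (∀ u → R u → Q (T u) ⊎ (R (T u) × h (T u) < h u)) →
    ∀ u → R u → StutterRun u
  ranking⇒stutterRun h descend u Ru = go u Ru (<-wellFounded (h u))
    where
    go : ∀ u → R u → Acc _<_ (h u) → StutterRun u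
    go u Ru (acc rs) with descend u Ru
    ... | inj₁ QTu         = stutterRun-exit QTu
    ... | inj₂ (RTu , h<) = stutterRun-stutter RTu (go (T u) RTu (rs h<))

theorem2 : {a b ℓ : Level} (M : DLTS a b) (P : Partition {a} {b} {ℓ} M) →
    LabelPreserving M P →
    (∀ (r : DLTS.S M) → Σ (DLTS.S M → ℕ) λ h →
      ∀ (q : DLTS.S M) → QuotStep M P r q → ¬ (Partition._≃_ P q r) →
        ∀ (s : DLTS.S M) → Partition._≃_ P s r →
          Partition._≃_ P (DLTS.T M s) q
          ⊎ (Partition._≃_ P (DLTS.T M s) r × h (DLTS.T M s) < h s)) →
    StutterInsensitiveBisimulation M P
theorem2 M P labelPreserving ranking = labelPreserving , bisim
  where
  open DLTS M
  open Partition P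
  open IsEquivalence isEquivalence renaming (refl to ≃-refl; sym to ≃-sym)

  bisim : ∀ s s' t → s ≃ t → ¬ (s ≃ s') → s' ≡ T s → StutterRun T (_≃ s) (_≃ s') t
  bisim s _ t s≃t s≄Ts refl =
    ranking⇒stutterRun T (_≃ s) (_≃ T s) h descend t (≃-sym s≃t)
    where
    h : S → ℕ
    h = proj₁ (ranking s)

    Ts≄s : ¬ (T s ≃ s)
    Ts≄s = s≄Ts ∘ ≃-sym

    descend : ∀ u → u ≃ s → T u ≃ T s ⊎ (T u ≃ s × h (T u) < h u)
    descend = proj₂ (ranking s) (T s) (inj₁ (Ts≄s , s , ≃-refl , ≃-refl)) Ts≄s
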